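{- Let $A$ be a finite set of atoms. The set of all proper propositional Horn theories over $A$ (theories containing no facts) is a subnear-semiring of $(\mathcal H_A,\cup,\circ,\emptyset)$, and $\emptyset$ is a zero for it: $\emptyset\circ P=\emptyset=P\circ\emptyset$ for every proper theory $P$.
   Context: A theory over $A$ is a finite set of rules $a_0\leftarrow a_1,\ldots,a_k$ ($k\ge0$, $a_i\in A$), with $head(r)=\{a_0\}$, $body(r)=\{a_1,\ldots,a_k\}$, size $k$; $head(S),body(S)$ are unions over a set $S$ of rules. $\mathcal H_A$ is the set of all theories over $A$. A fact is a rule with empty body. Write $S\subseteq_r R$ if $S\subseteq R$ has as many elements as the size of $r$. Composition: $P\circ R=\{head(r)\leftarrow body(S)\mid r\in P,\ S\subseteq_r R,\ head(S)=body(r)\}$. A near-semiring is $(S,+,\cdot,0)$ with $(S,+,0)$ a monoid, $(S,\cdot)$ a semigroup, $(x+y)z=xz+yz$ and $0x=0$; a subnear-semiring is a subset containing $0$ and closed under $+$ and $\cdot$. -}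

module Defs where

open import Data.Nat using (ℕ)
open import Data.Fin using (Fin)
open import Data.Fin.Subset using (Subset; ⁅_⁆; _∪_; ∣_∣) renaming (⊥ to ∅ˢ)
open import Data.List using (List; []; _∷_; foldr; length)
open import Data.List.Relation.Unary.All using (All)
open import Data.List.Relation.Unary.Unique.Propositional using (Unique)
open import Data.Product using (Σ; _×_)
open import Data.Sum using (_⊎_)
open import Data.Empty using (⊥)
open import Relation.Nullary using (¬_)
open import Relation.Binary.PropositionalEquality using (_≡_)

-- Atoms: the finite set A is represented as Fin n.
-- A rule  a₀ ← a₁,…,aₖ  has a head atom and a body, which is a SET of atoms
-- (represented canonically as a Subset n, so ≡ is set equality).
record Rule (n : ℕ) : Set where
  constructor _←_
  field
    head : Fin n
    body : Subset n
open Rule public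

size : ∀ {n} → Rule n → ℕ
size r = ∣ body r ∣

IsFact : ∀ {n} → Rule n → Set
IsFact r = body r ≡ ∅ˢ

-- A theory is a set of rules.  Since A is finite there are finitely many
-- rules, so every set of rules is finite.  Sets are predicates on rules.
Theory : ℕ → Set₁
Theory n = Rule n → Set

_≐_ : ∀ {n} → Theory n → Theory n → Set
P ≐ R = ∀ r → (P r → R r) × (R r → P r)

∅ : ∀ {n} → Theory n
∅ _ = ⊥

_∪ₜ_ : ∀ {n} → Theory n → Theory n → Theory n
(P ∪ₜ R) r = P r ⊎ R r

heads : ∀ {n} → List (Rule n) → Subset n
heads = foldr (λ s acc → ⁅ head s ⁆ ∪ acc) ∅ˢ

bodies : ∀ {n} → List (Rule n) → Subset n
bodies = foldr (λ s acc → body s ∪ acc) ∅ˢ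

-- S ⊆ᵣ R : S is a subset of R (a duplicate-free list of rules of R)
-- having exactly as many elements as the size of r
_⊆[_]_ : ∀ {n} → List (Rule n) → Rule n → Theory n → Set
S ⊆[ r ] R = Unique S × All R S × length S ≡ size r

-- sequential composition
-- P ∘ R = { head(r) ← body(S) | r ∈ P, S ⊆ᵣ R, head(S) = body(r) }
_∘ₜ_ : ∀ {n} → Theory n → Theory n → Theory n
(P ∘ₜ R) r′ =
  Σ (Rule n) λ r → P r ×
  Σ (List (Rule n)) λ S → S ⊆[ r ] R × heads S ≡ body r ×
    (head r′ ≡ head r × body r′ ≡ bodies S)
  where n = _

Proper : ∀ {n} → Theory n → Set
Proper P = ∀ r → P r → ¬ IsFact r

record IsSubNearSemiring {C : Set₁} (_+_ _·_ : C → C → C) (0# : C)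
                         (X : C → Set) : Set₁ where
  field
    contains-0 : X 0#
    closed-+   : ∀ x y → X x → X y → X (x + y)
    closed-·   : ∀ x y → X x → X y → X (x · y)

-- A rule of P ∘ R built from r ∈ P and S ⊆ᵣ R either has S empty, and then
-- body r = head(S) = ∅ makes r a fact of P, or S contains some s ∈ R whose body
-- lies in the composite body; so a composite fact forces a fact in P or in R.
-- The same dichotomy gives P ∘ ∅ = ∅ for proper P, while ∅ ∘ P = ∅ is immediate.
module Submission where

open import Defs
open import Data.Nat using (ℕ)
open import Data.Product using (∃; _×_; _,_)
open import Data.Sum using (_⊎_; inj₁; inj₂)
open import Data.List using ([]; _∷_)
open import Data.List.Relation.Unary.All using (_∷_)
open import Data.Fin.Subset using (Subset; _⊆_) renaming (⊥ to ∅ˢ)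
open import Data.Fin.Subset.Properties using (⊆-antisym; ⊆-trans; ⊆-reflexive; ⊥⊆; p⊆p∪q)
open import Relation.Binary.PropositionalEquality using (_≡_; sym)

⊆∅ˢ⇒≡∅ˢ : ∀ {n} {p : Subset n} → p ⊆ ∅ˢ → p ≡ ∅ˢ
⊆∅ˢ⇒≡∅ˢ p⊆∅ = ⊆-antisym p⊆∅ ⊥⊆

∘ₜ-origin : ∀ {n} {P R : Theory n} {r : Rule n} → (P ∘ₜ R) r →
            (∃ λ q → P q × IsFact q) ⊎ (∃ λ s → R s × body s ⊆ body r)
∘ₜ-origin (q , Pq , [] , _ , heads≡body , _) = inj₁ (q , Pq , sym heads≡body)
∘ₜ-origin (_ , _ , s ∷ S , (_ , Rs ∷ _ , _) , _ , _ , body≡bodies) =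
  inj₂ (s , Rs , ⊆-trans (p⊆p∪q _) (⊆-reflexive (sym body≡bodies)))

Proper-∪ₜ : ∀ {n} (P R : Theory n) → Proper P → Proper R → Proper (P ∪ₜ R)
Proper-∪ₜ P R properP properR r (inj₁ Pr) = properP r Pr
Proper-∪ₜ P R properP properR r (inj₂ Rr) = properR r Rr

Proper-∘ₜ : ∀ {n} (P R : Theory n) → Proper P → Proper R → Proper (P ∘ₜ R)
Proper-∘ₜ P R properP properR r PRr r-fact with ∘ₜ-origin PRr
... | inj₁ (q , Pq , q-fact)     = properP q Pq q-fact
... | inj₂ (s , Rs , body-s⊆) = properR s Rs (⊆∅ˢ⇒≡∅ˢ (⊆-trans body-s⊆ (⊆-reflexive r-fact)))

∘ₜ-zeroˡ : ∀ {n} (P : Theory n) → (∅ ∘ₜ P) ≐ ∅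
∘ₜ-zeroˡ P r = (λ { (_ , () , _) }) , λ ()

∘ₜ-zeroʳ : ∀ {n} (P : Theory n) → Proper P → (P ∘ₜ ∅) ≐ ∅
∘ₜ-zeroʳ P properP r = from , λ ()
  where
  from : (P ∘ₜ ∅) r → ∅ r
  from Pr with ∘ₜ-origin Pr
  ... | inj₁ (q , Pq , q-fact) = properP q Pq q-fact

proposition3p9 : (n : ℕ) →
    IsSubNearSemiring {Theory n} _∪ₜ_ _∘ₜ_ ∅ Proper
    × (∀ (P : Theory n) → Proper P → ((∅ ∘ₜ P) ≐ ∅) × ((P ∘ₜ ∅) ≐ ∅))
proposition3p9 n =
  record { contains-0 = λ _ ()
         ; closed-+   = Proper-∪ₜ
         ; closed-·   = Proper-∘ₜ
         }
  , λ P properP → ∘ₜ-zeroˡ P , ∘ₜ-zeroʳ P properP
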